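{- Every deterministic max-finding algorithm with error $k$ requires $\Omega\big(n^{1+1/(2^k-1)}\big)$ comparisons on $n$ elements.
   Context: Model: each element $x_i$ has an unknown real value $\mathrm{val}(x_i)$. A comparator query on $x_i,x_j$ returns "$x_i\ge x_j$" or "$x_j\ge x_i$"; the answer is correct if $|\mathrm{val}(x_i)-\mathrm{val}(x_j)|>1$ and arbitrary (possibly adversarial) otherwise. A max-finding algorithm has error $k$ if on every input and every consistent comparator behavior its output $x$ satisfies $\mathrm{val}(x)\ge\mathrm{val}(x_i)-k$ for all $i$. -}

module Defs where

open import Data.Nat as ℕ using (ℕ; zero; suc; _^_; _∸_)
open import Data.Fin using (Fin)
open import Data.Integer using (+_)
open import Data.Rational using (ℚ; _≤_; _+_; _-_; _/_; 1ℚ)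

-- A deterministic comparison-based algorithm on n elements, as a (finite)
-- decision tree.  'query i j l r' compares x_i with x_j; the algorithm
-- continues in l if the answer is "x_i ≥ x_j" and in r if it is "x_j ≥ x_i".
-- 'output x' stops and returns x.
data Alg (n : ℕ) : Set where
  output : Fin n → Alg n
  query  : Fin n → Fin n → Alg n → Alg n → Alg n

ℕ→ℚ : ℕ → ℚ
ℕ→ℚ k = (+ k) / 1

-- Run val A x c : on input values 'val', some comparator behaviour consistent
-- with the model (an answer is forced to be correct only when the two values
-- differ by more than 1) makes A output x after exactly c comparisons.
data Run {n : ℕ} (val : Fin n → ℚ) : Alg n → Fin n → ℕ → Set where
  stop  : ∀ {x} → Run val (output x) x 0
  left  : ∀ {i j l r x c} → val j ≤ val i + 1ℚ →
          Run val l x c → Run val (query i j l r) x (suc c)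
  right : ∀ {i j l r x c} → val i ≤ val j + 1ℚ →
          Run val r x c → Run val (query i j l r) x (suc c)

HasError : {n : ℕ} → ℕ → Alg n → Set
HasError {n} k A =
  (val : Fin n → ℚ) (x : Fin n) (c : ℕ) → Run val A x c →
  (i : Fin n) → val i - ℕ→ℚ k ≤ val x

Requires : {n : ℕ} → Alg n → ℕ → Set
Requires {n} A q =
  Data.Product.Σ (Fin n → ℚ) λ val → Data.Product.Σ (Fin n) λ x →
  Data.Product.Σ ℕ λ c → Data.Product._×_ (Run val A x c) (q ℕ.≤ c)
  where import Data.Product

module Submission where

-- Each query is won by the element with fewer wins so far, giving
-- a win graph g (an edge v → w when v beat w).  When A stops with output x
-- after c comparisons, give z the value min (dist_g(x, z), k + 1).  Along an
-- edge the value rises by at most one, so every answer was legal; hence error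
-- k forces all n elements into the ball B k of radius k around x.
--
-- The win lists are ranked: the p-th loser of v has ≥ p wins.  So a
-- vertex entering B (m+1) either has ≥ t wins (at most c/t such vertices) or
-- is among the first t losers of a vertex of B m (at most t |B m| such).  The
-- sizes b m = |B m| thus satisfy b 0 = 1, b (m+1) ≤ b m + c and, for all t,
-- t b (m+1) ≤ t b m + c + t² b m.  Taking t ≈ √(c / b m) gives
-- b (m+1)² ≤ 18 b m (c + b m), and iterating k times bounds n = b k.

open import Defs
open import Data.Nat using (ℕ; suc; _*_; _^_; _∸_; _≤_; _≥_)
open import Data.Product using (Σ; _×_)

open import Data.Nat using (zero; _+_; _<_; z≤n; s≤s; _≤?_; _<?_; NonZero; >-nonZero)
open import Data.Nat.Properties hiding (_≟_)
open import Data.Nat.Tactic.RingSolver using (solve; solve-∀)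
open import Algebra.Properties.Semiring.Sum +-*-semiring
  using (sum; sum-syntax; sum-cong-≗; sum-replicate-zero; ∑-distrib-+; ∑-comm; *-distribˡ-sum)
open import Data.Bool using (if_then_else_)
open import Data.Fin using (Fin; zero; suc)
open import Data.Fin.Properties using (_≟_; any?)
open import Data.List using (List; []; _∷_; length)
open import Data.List.Membership.Propositional using (_∈_)
open import Data.List.Relation.Unary.Any using (here; there)
open import Data.Product using (_,_; ∃-syntax)
open import Data.Sum using (_⊎_; inj₁; inj₂)
open import Data.Unit using (⊤)
open import Function using (_∘_)
open import Relation.Nullary using (Dec; yes; no; does; ¬_; ¬?; _⊎-dec_; _×-dec_; contradiction)
open import Relation.Nullary.Decidable using (dec-true; dec-false; decidable-stable)
open import Relation.Unary using (Decidable)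
import Data.Integer as ℤ
import Data.Integer.Properties as ℤP
open import Data.Rational as ℚ using (ℚ; mkℚ; 1ℚ; *≤*)
import Data.Rational.Properties as ℚP
import Data.Nat.Coprimality as Coprime
open import Relation.Binary.PropositionalEquality
  using (_≡_; refl; sym; trans; cong; cong₂; subst; subst₂; module ≡-Reasoning)

∑-mono-≤ : ∀ {n} {f g : Fin n → ℕ} → (∀ i → f i ≤ g i) → sum f ≤ sum g
∑-mono-≤ {zero}  _   = z≤n
∑-mono-≤ {suc n} f≤g = +-mono-≤ (f≤g zero) (∑-mono-≤ (f≤g ∘ suc))

term≤∑ : ∀ {n} (f : Fin n → ℕ) i → f i ≤ sum f
term≤∑ f zero    = m≤m+n _ _
term≤∑ f (suc i) = ≤-trans (term≤∑ (f ∘ suc) i) (m≤n+m _ _)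

∑-ones : ∀ n → ∑[ i < n ] 1 ≡ n
∑-ones zero    = refl
∑-ones (suc n) = cong suc (∑-ones n)

𝟙 : ∀ {a} {A : Set a} → Dec A → ℕ
𝟙 a? = if does a? then 1 else 0

𝟙-yes : ∀ {a} {A : Set a} (a? : Dec A) → A → 𝟙 a? ≡ 1
𝟙-yes a? a rewrite dec-true a? a = refl

𝟙-no : ∀ {a} {A : Set a} (a? : Dec A) → ¬ A → 𝟙 a? ≡ 0
𝟙-no a? ¬a rewrite dec-false a? ¬a = refl

𝟙≤1 : ∀ {a} {A : Set a} (a? : Dec A) → 𝟙 a? ≤ 1
𝟙≤1 (yes _) = s≤s z≤n
𝟙≤1 (no _)  = z≤n

𝟙-bound : ∀ {a} {A : Set a} {x} (a? : Dec A) → (A → 1 ≤ x) → 𝟙 a? ≤ x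
𝟙-bound (yes a) pos = pos a
𝟙-bound (no _)  _   = z≤n

∑-𝟙≟ : ∀ {n} (w : Fin n) → ∑[ z < n ] 𝟙 (w ≟ z) ≡ 1
∑-𝟙≟ {suc n} zero    = cong suc (sum-replicate-zero n)
∑-𝟙≟ {suc n} (suc w) = ∑-𝟙≟ w

-- g v lists the elements v has beaten, most recent first.
Wins : ℕ → Set
Wins n = Fin n → List (Fin n)

module _ {n : ℕ} where

  deg : Wins n → Fin n → ℕ
  deg g v = length (g v)

  edges : Wins n → ℕ
  edges g = ∑[ v < n ] deg g v

  occ : Fin n → List (Fin n) → ℕ
  occ z []      = 0
  occ z (w ∷ r) = 𝟙 (w ≟ z) + occ z r

  ∑-occ : ∀ L → ∑[ z < n ] occ z L ≡ length L
  ∑-occ []      = sum-replicate-zero n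
  ∑-occ (w ∷ r) = begin
    ∑[ z < n ] (𝟙 (w ≟ z) + occ z r)              ≡⟨ ∑-distrib-+ (λ z → 𝟙 (w ≟ z)) (λ z → occ z r) ⟩
    ∑[ z < n ] 𝟙 (w ≟ z) + ∑[ z < n ] occ z r     ≡⟨ cong₂ _+_ (∑-𝟙≟ w) (∑-occ r) ⟩
    suc (length r)                                 ∎
    where open ≡-Reasoning

  ∈⇒occ : ∀ {z L} → z ∈ L → 1 ≤ occ z L
  ∈⇒occ {z} (here refl) = ≤-trans (≤-reflexive (sym (𝟙-yes (z ≟ z) refl))) (m≤m+n _ _)
  ∈⇒occ     (there z∈r) = ≤-trans (∈⇒occ z∈r) (m≤n+m _ _)

  -- Ranked g L: the entry of L added when its owner had p wins (the entry
  -- sitting above a tail of length p) has itself at least p wins in g.  The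
  -- adversary keeps all win lists ranked, as a winner never has more wins than
  -- its loser.
  Ranked : Wins n → List (Fin n) → Set
  Ranked g []      = ⊤
  Ranked g (w ∷ r) = length r ≤ deg g w × Ranked g r

  AllRanked : Wins n → Set
  AllRanked g = ∀ v → Ranked g (g v)

  Ranked-mono : ∀ {g g′} → (∀ u → deg g u ≤ deg g′ u) → ∀ L → Ranked g L → Ranked g′ L
  Ranked-mono grow []      _          = _
  Ranked-mono grow (w ∷ r) (r≤w , rk) = ≤-trans r≤w (grow w) , Ranked-mono grow r rk

  -- The entries added while the owner had fewer than t wins: a suffix of length ≤ t.
  early : ℕ → List (Fin n) → List (Fin n)
  early t []      = []
  early t (w ∷ r) with length r <? t
  ... | yes _ = w ∷ r
  ... | no  _ = early t r

  early-≤t : ∀ t L → length (early t L) ≤ t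
  early-≤t t []      = z≤n
  early-≤t t (w ∷ r) with length r <? t
  ... | yes r<t = r<t
  ... | no  _   = early-≤t t r

  early-≤length : ∀ t L → length (early t L) ≤ length L
  early-≤length t []      = z≤n
  early-≤length t (w ∷ r) with length r <? t
  ... | yes _ = ≤-refl
  ... | no  _ = m≤n⇒m≤1+n (early-≤length t r)

  early-or-strong : ∀ {g} t {z} L → Ranked g L → z ∈ L → z ∈ early t L ⊎ t ≤ deg g z
  early-or-strong t (w ∷ r) (r≤w , rk) z∈L with length r <? t
  ... | yes _ = inj₁ z∈L
  early-or-strong t (w ∷ r) (r≤w , rk) (here refl)  | no r≮t = inj₂ (≤-trans (≮⇒≥ r≮t) r≤w)
  early-or-strong t (w ∷ r) (r≤w , rk) (there z∈r)  | no _   = early-or-strong t r rk z∈r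

  heavy : Wins n → ℕ → ℕ
  heavy g t = ∑[ z < n ] 𝟙 (t ≤? deg g z)

  heavy-bound : ∀ g t → t * heavy g t ≤ edges g
  heavy-bound g t = begin
    t * heavy g t                  ≡⟨ *-distribˡ-sum t (λ z → 𝟙 (t ≤? deg g z)) ⟩
    ∑[ z < n ] (t * 𝟙 (t ≤? deg g z)) ≤⟨ ∑-mono-≤ (λ z → pointwise (t ≤? deg g z)) ⟩
    edges g                         ∎
    where
    open ≤-Reasoning
    pointwise : ∀ {d} (t≤d? : Dec (t ≤ d)) → t * 𝟙 t≤d? ≤ d
    pointwise (yes t≤d) = ≤-trans (≤-reflexive (*-identityʳ t)) t≤d
    pointwise (no  _)   = ≤-trans (≤-reflexive (*-zeroʳ t)) z≤n

module Balls {n : ℕ} (g : Wins n) (root : Fin n) where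

  open import Data.List.Membership.DecPropositional (_≟_ {n}) using (_∈?_)

  B : ℕ → Fin n → Set
  B zero    z = root ≡ z
  B (suc m) z = B m z ⊎ ∃[ v ] (B m v × z ∈ g v)

  B? : ∀ m → Decidable (B m)
  B? zero    z = root ≟ z
  B? (suc m) z = B? m z ⊎-dec any? (λ v → B? m v ×-dec (z ∈? g v))

  size : ℕ → ℕ
  size m = ∑[ z < n ] 𝟙 (B? m z)

  root∈B : ∀ m → B m root
  root∈B zero    = refl
  root∈B (suc m) = inj₁ (root∈B m)

  size-0 : size 0 ≡ 1
  size-0 = ∑-𝟙≟ root

  size≥1 : ∀ m → 1 ≤ size m
  size≥1 m = ≤-trans (≤-reflexive (sym (𝟙-yes (B? m root) (root∈B m))))
                     (term≤∑ (λ z → 𝟙 (B? m z)) root)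

  size-all : ∀ m → (∀ z → B m z) → size m ≡ n
  size-all m all = trans (sum-cong-≗ (λ z → 𝟙-yes (B? m z) (all z))) (∑-ones n)

  earlyFrom : ℕ → ℕ → ℕ
  earlyFrom m t = ∑[ v < n ] (𝟙 (B? m v) * length (early t (g v)))

  earlyFrom-≤size : ∀ m t → earlyFrom m t ≤ t * size m
  earlyFrom-≤size m t = begin
    earlyFrom m t                     ≤⟨ ∑-mono-≤ (λ v → *-monoʳ-≤ (𝟙 (B? m v)) (early-≤t t (g v))) ⟩
    ∑[ v < n ] (𝟙 (B? m v) * t)       ≡⟨ sum-cong-≗ (λ v → *-comm (𝟙 (B? m v)) t) ⟩
    ∑[ v < n ] (t * 𝟙 (B? m v))       ≡⟨ sym (*-distribˡ-sum t (λ v → 𝟙 (B? m v))) ⟩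
    t * size m                        ∎
    where open ≤-Reasoning

  earlyFrom-≤edges : ∀ m t → earlyFrom m t ≤ edges g
  earlyFrom-≤edges m t = ∑-mono-≤ λ v →
    ≤-trans (*-mono-≤ (𝟙≤1 (B? m v)) (early-≤length t (g v))) (≤-reflexive (+-identityʳ _))

  enter : AllRanked g → ∀ t m z →
    𝟙 (B? (suc m) z) ≤ 𝟙 (B? m z) + 𝟙 (t ≤? deg g z) + ∑[ v < n ] (𝟙 (B? m v) * occ z (early t (g v)))
  enter ranked t m z = 𝟙-bound (B? (suc m) z) cases
    where
    cases : B (suc m) z → 1 ≤ _
    cases (inj₁ z∈B) = ≤-trans (≤-reflexive (sym (𝟙-yes (B? m z) z∈B))) (≤-trans (m≤m+n _ _) (m≤m+n _ _))
    cases (inj₂ (v , v∈B , z∈gv)) with early-or-strong t (g v) (ranked v) z∈gv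
    ... | inj₂ strong = ≤-trans (≤-reflexive (sym (𝟙-yes (t ≤? deg g z) strong))) (≤-trans (m≤n+m _ (𝟙 (B? m z))) (m≤m+n _ _))
    ... | inj₁ z∈early = ≤-trans viaEdge (m≤n+m _ _)
      where
      viaEdge : 1 ≤ ∑[ u < n ] (𝟙 (B? m u) * occ z (early t (g u)))
      viaEdge = ≤-trans (*-mono-≤ (≤-reflexive (sym (𝟙-yes (B? m v) v∈B))) (∈⇒occ z∈early))
                        (term≤∑ (λ u → 𝟙 (B? m u) * occ z (early t (g u))) v)

  size-step : AllRanked g → ∀ t m → size (suc m) ≤ size m + heavy g t + earlyFrom m t
  size-step ranked t m = begin
    size (suc m)                                                  ≤⟨ ∑-mono-≤ (enter ranked t m) ⟩
    ∑[ z < n ] (𝟙 (B? m z) + 𝟙 (t ≤? deg g z) + viaEdges z)       ≡⟨ ∑-distrib-+ (λ z → 𝟙 (B? m z) + 𝟙 (t ≤? deg g z)) viaEdges ⟩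
    ∑[ z < n ] (𝟙 (B? m z) + 𝟙 (t ≤? deg g z)) + ∑[ z < n ] viaEdges z
                                                                  ≡⟨ cong₂ _+_ (∑-distrib-+ (λ z → 𝟙 (B? m z)) (λ z → 𝟙 (t ≤? deg g z))) swap ⟩
    size m + heavy g t + earlyFrom m t                            ∎
    where
    open ≤-Reasoning
    viaEdges : Fin n → ℕ
    viaEdges z = ∑[ v < n ] (𝟙 (B? m v) * occ z (early t (g v)))
    swap : ∑[ z < n ] viaEdges z ≡ earlyFrom m t
    swap = trans (∑-comm (λ z v → 𝟙 (B? m v) * occ z (early t (g v))))
                 (sum-cong-≗ λ v → trans (sym (*-distribˡ-sum (𝟙 (B? m v)) (λ z → occ z (early t (g v)))))
                                         (cong (𝟙 (B? m v) *_) (∑-occ (early t (g v)))))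

  -- Taking t above the number of edges: no vertex is heavy.
  size-linear : AllRanked g → ∀ m → size (suc m) ≤ size m + edges g
  size-linear ranked m = begin
    size (suc m)                           ≤⟨ size-step ranked t m ⟩
    size m + heavy g t + earlyFrom m t     ≡⟨ cong (λ h → size m + h + earlyFrom m t) noHeavy ⟩
    size m + 0 + earlyFrom m t             ≤⟨ +-monoʳ-≤ (size m + 0) (earlyFrom-≤edges m t) ⟩
    size m + 0 + edges g                   ≡⟨ cong (_+ edges g) (+-identityʳ (size m)) ⟩
    size m + edges g                       ∎
    where
    open ≤-Reasoning
    t = suc (edges g)
    noHeavy : heavy g t ≡ 0
    noHeavy = n<1⇒n≡0 (*-cancelˡ-< t _ 1 (≤-trans (s≤s (heavy-bound g t)) (≤-reflexive (sym (*-identityʳ t)))))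

  size-quadratic : AllRanked g → ∀ m t → t * size (suc m) ≤ t * size m + edges g + t * (t * size m)
  size-quadratic ranked m t = begin
    t * size (suc m)                                    ≤⟨ *-monoʳ-≤ t (size-step ranked t m) ⟩
    t * (size m + heavy g t + earlyFrom m t)            ≡⟨ trans (*-distribˡ-+ t (size m + heavy g t) (earlyFrom m t))
                                                                (cong (_+ t * earlyFrom m t) (*-distribˡ-+ t (size m) (heavy g t))) ⟩
    t * size m + t * heavy g t + t * earlyFrom m t      ≤⟨ +-mono-≤ (+-monoʳ-≤ (t * size m) (heavy-bound g t))
                                                                    (*-monoʳ-≤ t (earlyFrom-≤size m t)) ⟩
    t * size m + edges g + t * (t * size m)             ∎
    where open ≤-Reasoning

  -- level r z = #{m < r : z ∉ B m} = min (dist(root, z), r).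
  level : ℕ → Fin n → ℕ
  level zero    z = 0
  level (suc m) z = 𝟙 (¬? (B? m z)) + level m z

  level-root : ∀ m → level m root ≡ 0
  level-root zero    = refl
  level-root (suc m) = cong₂ _+_ (𝟙-no (¬? (B? m root)) (λ ∉ → ∉ (root∈B m))) (level-root m)

  level-mono : ∀ m z → level m z ≤ level (suc m) z
  level-mono m z = m≤n+m _ _

  level-edge : ∀ {v w} → w ∈ g v → ∀ m → level (suc m) w ≤ suc (level m v)
  level-edge {w = w} w∈gv zero = ≤-trans (≤-reflexive (+-identityʳ _)) (𝟙≤1 (¬? (B? 0 w)))
  level-edge {v} {w} w∈gv (suc m) =
    ≤-trans (+-mono-≤ outsideStep (level-edge w∈gv m)) (≤-reflexive (+-suc _ _))
    where
    outsideStep : 𝟙 (¬? (B? (suc m) w)) ≤ 𝟙 (¬? (B? m v))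
    outsideStep with B? m v
    ... | yes v∈B = ≤-reflexive (𝟙-no (¬? (B? (suc m) w)) (λ ∉ → ∉ (inj₂ (v , v∈B , w∈gv))))
    ... | no  _   = 𝟙≤1 (¬? (B? (suc m) w))

  level-outside : ∀ m z → ¬ B m z → level (suc m) z ≡ suc m
  level-outside zero    z ∉ = cong (_+ 0) (𝟙-yes (¬? (B? 0 z)) ∉)
  level-outside (suc m) z ∉ = cong₂ _+_ (𝟙-yes (¬? (B? (suc m) z)) ∉) (level-outside m z (∉ ∘ inj₁))

  level-≤⇒B : ∀ m z → level (suc m) z ≤ m → B m z
  level-≤⇒B m z low = decidable-stable (B? m z)
    (λ z∉B → 1+n≰n (subst (_≤ m) (level-outside m z z∉B) low))

sqrt-bracket : ∀ b .{{_ : NonZero b}} c → ∃[ s ] (s * s * b ≤ c × c < suc s * suc s * b)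
sqrt-bracket b zero    = 0 , z≤n , m≤m*n 1 b
sqrt-bracket b (suc c) with sqrt-bracket b c
... | s , low , high with suc c <? suc s * suc s * b
...   | yes below = s , m≤n⇒m≤1+n low , below
...   | no  above = suc s , ≮⇒≥ above , (begin-strict
  suc c                          ≤⟨ high ⟩
  suc s * suc s * b              <⟨ *-monoˡ-< b (*-mono-< (n<1+n (suc s)) (n<1+n (suc s))) ⟩
  suc (suc s) * suc (suc s) * b  ∎)
  where open ≤-Reasoning

-- 2s ≤ s² + 1, which bounds (s+1)² by 2s² + 2.
twice≤square+1 : ∀ s → s + s ≤ s * s + 1
twice≤square+1 zero    = z≤n
twice≤square+1 (suc u) = begin
  suc u + suc u            ≡⟨ solve (u ∷ []) ⟩
  u + u + 2                ≤⟨ m≤n+m (u + u + 2) (u * u) ⟩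
  u * u + (u + u + 2)      ≡⟨ solve (u ∷ []) ⟩
  suc u * suc u + 1        ∎
  where open ≤-Reasoning

-- Optimising the free parameter t in  t b ≤ t b' + c + t² b'  (take t ≈ √(c/b')).
square-bound : ∀ b b′ c → 1 ≤ b′ → (∀ t → t * b ≤ t * b′ + c + t * (t * b′)) →
               b * b ≤ 18 * (b′ * (c + b′))
square-bound b b′ c b′≥1 hyp with sqrt-bracket b′ {{>-nonZero b′≥1}} c
... | s , low , high = begin
  b * b                         ≤⟨ *-mono-≤ b≤ b≤ ⟩
  3 * (t * b′) * (3 * (t * b′))  ≡⟨ regroup t b′ ⟩
  9 * b′ * (t * t * b′)          ≤⟨ *-monoʳ-≤ (9 * b′) t²b′≤ ⟩
  9 * b′ * (2 * c + 2 * b′)      ≡⟨ solve (b′ ∷ c ∷ []) ⟩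
  18 * (b′ * (c + b′))           ∎
  where
  open ≤-Reasoning
  regroup : ∀ x y → 3 * (x * y) * (3 * (x * y)) ≡ 9 * y * (x * x * y)
  regroup = solve-∀
  triple : ∀ x y → x * y + x * y + x * y ≡ x * (3 * y)
  triple = solve-∀
  t = suc s
  c≤ : c ≤ t * (t * b′)
  c≤ = ≤-trans (<⇒≤ high) (≤-reflexive (*-assoc t t b′))
  b≤ : b ≤ 3 * (t * b′)
  b≤ = *-cancelˡ-≤ t (begin
    t * b                                      ≤⟨ hyp t ⟩
    t * b′ + c + t * (t * b′)                  ≤⟨ +-monoˡ-≤ (t * (t * b′)) (+-mono-≤ (m≤n*m (t * b′) t) c≤) ⟩
    t * (t * b′) + t * (t * b′) + t * (t * b′)  ≡⟨ triple t (t * b′) ⟩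
    t * (3 * (t * b′))                         ∎)
  t²b′≤ : t * t * b′ ≤ 2 * c + 2 * b′
  t²b′≤ = begin
    suc s * suc s * b′             ≡⟨ solve (s ∷ b′ ∷ []) ⟩
    s * s * b′ + (s + s) * b′ + b′ ≤⟨ +-monoˡ-≤ b′ (+-monoʳ-≤ (s * s * b′) (*-monoˡ-≤ b′ (twice≤square+1 s))) ⟩
    s * s * b′ + (s * s + 1) * b′ + b′ ≡⟨ solve (s ∷ b′ ∷ []) ⟩
    2 * (s * s * b′) + 2 * b′      ≤⟨ +-monoˡ-≤ (2 * b′) (*-monoʳ-≤ 2 low) ⟩
    2 * c + 2 * b′                 ∎

^-distribʳ-* : ∀ x y e → (x * y) ^ e ≡ x ^ e * y ^ e
^-distribʳ-* x y zero    = refl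
^-distribʳ-* x y (suc e) = trans (cong (x * y *_) (^-distribʳ-* x y e)) (interchange x y (x ^ e) (y ^ e))
  where
  interchange : ∀ a b c d → a * b * (c * d) ≡ a * c * (b * d)
  interchange = solve-∀

^-2^suc : ∀ x m → x ^ (2 ^ suc m) ≡ (x * x) ^ (2 ^ m)
^-2^suc x m = trans (sym (^-*-assoc x 2 (2 ^ m))) (cong (λ y → (x * y) ^ (2 ^ m)) (*-identityʳ x))

E : ℕ → ℕ
E m = 18 * suc (suc m)

K : ℕ → ℕ
K zero    = 1
K (suc m) = E m ^ (2 ^ m) * K m

module Recurrence (f : ℕ → ℕ) (e : ℕ) (f-0 : f 0 ≡ 1)
                  (f-linear : ∀ m → f (suc m) ≤ f m + e)
                  (f-square : ∀ m → f (suc m) * f (suc m) ≤ 18 * (f m * (e + f m))) where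

  open ≤-Reasoning

  C : ℕ
  C = suc e

  linear-bound : ∀ m → f m ≤ suc (m * e)
  linear-bound zero    = ≤-reflexive f-0
  linear-bound (suc m) = ≤-trans (f-linear m) (≤-trans (+-monoˡ-≤ e (linear-bound m))
                                                       (≤-reflexive (cong suc (+-comm (m * e) e))))

  -- The squaring step with e + f m bounded linearly in C = e + 1.
  square-step : ∀ m → f (suc m) * f (suc m) ≤ E m * f m * C
  square-step m = begin
    f (suc m) * f (suc m)             ≤⟨ f-square m ⟩
    18 * (f m * (e + f m))            ≤⟨ *-monoʳ-≤ 18 (*-monoʳ-≤ (f m) e+f≤) ⟩
    18 * (f m * (suc (suc m) * C))    ≡⟨ regroup (f m) m e ⟩
    E m * f m * C                     ∎
    where
    regroup : ∀ x m e → 18 * (x * (suc (suc m) * suc e)) ≡ 18 * suc (suc m) * x * suc e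
    regroup = solve-∀
    expand : ∀ m e → e + suc (m * e) + (m + e + 1) ≡ suc (suc m) * suc e
    expand = solve-∀
    e+f≤ : e + f m ≤ suc (suc m) * C
    e+f≤ = ≤-trans (+-monoʳ-≤ e (linear-bound m))
                   (≤-trans (m≤m+n (e + suc (m * e)) (m + e + 1)) (≤-reflexive (expand m e)))

  -- Iterating squaring: f m ^ (2^m) ≤ K m C^(2^m - 1), multiplied through by C.
  power-bound : ∀ m → f m ^ (2 ^ m) * C ≤ K m * C ^ (2 ^ m)
  power-bound zero    = ≤-reflexive (trans (cong (λ x → x * 1 * C) f-0) (base C))
    where
    base : ∀ c → 1 * 1 * c ≡ 1 * (c * 1)
    base = solve-∀
  power-bound (suc m) = begin
    f (suc m) ^ (2 ^ suc m) * C                  ≡⟨ cong (_* C) (^-2^suc (f (suc m)) m) ⟩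
    (f (suc m) * f (suc m)) ^ p * C             ≤⟨ *-monoˡ-≤ C (^-monoˡ-≤ p (square-step m)) ⟩
    (E m * f m * C) ^ p * C                     ≡⟨ cong (_* C) (trans (^-distribʳ-* (E m * f m) C p)
                                                      (cong (_* C ^ p) (^-distribʳ-* (E m) (f m) p))) ⟩
    E m ^ p * f m ^ p * C ^ p * C                ≡⟨ regroup (E m ^ p) (f m ^ p) (C ^ p) C ⟩
    E m ^ p * C ^ p * (f m ^ p * C)              ≤⟨ *-monoʳ-≤ (E m ^ p * C ^ p) (power-bound m) ⟩
    E m ^ p * C ^ p * (K m * C ^ p)              ≡⟨ regroup′ (E m ^ p) (C ^ p) (K m) ⟩
    K (suc m) * (C ^ p * C ^ p)                  ≡⟨ cong (K (suc m) *_) (trans (sym (^-distribʳ-* C C p)) (sym (^-2^suc C m))) ⟩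
    K (suc m) * C ^ (2 ^ suc m)                  ∎
    where
    p = 2 ^ m
    regroup : ∀ a b c d → a * b * c * d ≡ a * c * (b * d)
    regroup = solve-∀
    regroup′ : ∀ a c k → a * c * (k * c) ≡ a * k * (c * c)
    regroup′ = solve-∀

  -- Without comparisons nothing grows.
  e≥1 : ∀ m → 2 ≤ f m → 1 ≤ e
  e≥1 m two≤ = n≢0⇒n>0 λ e≡0 → 1+n≰n (≤-trans two≤ (≤-trans (linear-bound m)
                  (s≤s (≤-reflexive (trans (cong (m *_) e≡0) (*-zeroʳ m))))))

  final : ∀ k → 2 ≤ f k → f k ^ (2 ^ k) ≤ suc (K k * 2 ^ (2 ^ k ∸ 1)) * e ^ (2 ^ k ∸ 1)
  final k two≤ = begin
    f k ^ (2 ^ k)           ≤⟨ *-cancelʳ-≤ (f k ^ (2 ^ k)) (K k * C ^ q) C cancelC ⟩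
    K k * C ^ q             ≤⟨ *-monoʳ-≤ (K k) (^-monoˡ-≤ q C≤2e) ⟩
    K k * (2 * e) ^ q       ≡⟨ cong (K k *_) (^-distribʳ-* 2 e q) ⟩
    K k * (2 ^ q * e ^ q)   ≡⟨ sym (*-assoc (K k) (2 ^ q) (e ^ q)) ⟩
    K k * 2 ^ q * e ^ q     ≤⟨ m≤n+m (K k * 2 ^ q * e ^ q) (e ^ q) ⟩
    suc (K k * 2 ^ q) * e ^ q ∎
    where
    q = 2 ^ k ∸ 1
    C≤2e : C ≤ 2 * e
    C≤2e = begin
      suc e   ≡⟨ +-comm 1 e ⟩
      e + 1   ≤⟨ +-monoʳ-≤ e (e≥1 k two≤) ⟩
      e + e   ≡⟨ cong (e +_) (sym (+-identityʳ e)) ⟩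
      2 * e   ∎
    cancelC : f k ^ (2 ^ k) * C ≤ K k * C ^ q * C
    cancelC = begin
      f k ^ (2 ^ k) * C     ≤⟨ power-bound k ⟩
      K k * C ^ (2 ^ k)     ≡⟨ cong (λ x → K k * C ^ x) (sym (m+[n∸m]≡n (m^n>0 2 k))) ⟩
      K k * C ^ (1 + q)     ≡⟨ regroup (K k) C (C ^ q) ⟩
      K k * C ^ q * C       ∎
      where
      regroup : ∀ a c d → a * (c * d) ≡ a * d * c
      regroup = solve-∀

module _ {n : ℕ} where

  beat : Wins n → Fin n → Fin n → Wins n
  beat g v w u with v ≟ u
  ... | yes _ = w ∷ g u
  ... | no  _ = g u

  beat-deg : ∀ g v w u → deg (beat g v w) u ≡ 𝟙 (v ≟ u) + deg g u
  beat-deg g v w u with v ≟ u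
  ... | yes _ = refl
  ... | no  _ = refl

  beat-edges : ∀ g v w → edges (beat g v w) ≡ suc (edges g)
  beat-edges g v w = begin
    ∑[ u < n ] deg (beat g v w) u              ≡⟨ sum-cong-≗ (beat-deg g v w) ⟩
    ∑[ u < n ] (𝟙 (v ≟ u) + deg g u)           ≡⟨ ∑-distrib-+ (λ u → 𝟙 (v ≟ u)) (deg g) ⟩
    ∑[ u < n ] 𝟙 (v ≟ u) + edges g             ≡⟨ cong (_+ edges g) (∑-𝟙≟ v) ⟩
    suc (edges g)                              ∎
    where open ≡-Reasoning

  beat-keeps : ∀ g v w {u z} → z ∈ g u → z ∈ beat g v w u
  beat-keeps g v w {u} z∈gu with v ≟ u
  ... | yes _ = there z∈gu
  ... | no  _ = z∈gu

  beat-new : ∀ g v w → w ∈ beat g v w v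
  beat-new g v w with v ≟ v
  ... | yes _  = here refl
  ... | no v≢v = contradiction refl v≢v

  beat-grows : ∀ g v w u → deg g u ≤ deg (beat g v w) u
  beat-grows g v w u = ≤-trans (m≤n+m (deg g u) (𝟙 (v ≟ u))) (≤-reflexive (sym (beat-deg g v w u)))

  beat-ranked : ∀ g v w → deg g v ≤ deg g w → AllRanked g → AllRanked (beat g v w)
  beat-ranked g v w v≤w ranked u with v ≟ u
  ... | yes refl = ≤-trans v≤w (beat-grows g v w w) , Ranked-mono (beat-grows g v w) (g v) (ranked v)
  ... | no  _    = Ranked-mono (beat-grows g v w) (g u) (ranked u)

  record Outcome : Set where
    constructor outcome
    field
      winner      : Fin n
      comparisons : ℕ
      graph       : Wins n

  open Outcome public

  counted : Outcome → Outcome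
  counted (outcome x c g) = outcome x (suc c) g

  play : Alg n → Wins n → Outcome
  play (output x)      g = outcome x 0 g
  play (query i j l r) g with deg g i ≤? deg g j
  ... | yes _ = counted (play l (beat g i j))
  ... | no  _ = counted (play r (beat g j i))

  play-edges : ∀ A g → edges (graph (play A g)) ≡ comparisons (play A g) + edges g
  play-edges (output x)      g = refl
  play-edges (query i j l r) g with deg g i ≤? deg g j
  ... | yes _ = trans (play-edges l (beat g i j))
                      (trans (cong (comparisons (play l (beat g i j)) +_) (beat-edges g i j)) (+-suc _ _))
  ... | no  _ = trans (play-edges r (beat g j i))
                      (trans (cong (comparisons (play r (beat g j i)) +_) (beat-edges g j i)) (+-suc _ _))

  play-ranked : ∀ A g → AllRanked g → AllRanked (graph (play A g))
  play-ranked (output x)      g ranked = ranked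
  play-ranked (query i j l r) g ranked with deg g i ≤? deg g j
  ... | yes i≤j = play-ranked l (beat g i j) (beat-ranked g i j i≤j ranked)
  ... | no  i≰j = play-ranked r (beat g j i) (beat-ranked g j i (<⇒≤ (≰⇒> i≰j)) ranked)

  play-keeps : ∀ A g {v w} → w ∈ g v → w ∈ graph (play A g) v
  play-keeps (output x)      g w∈gv = w∈gv
  play-keeps (query i j l r) g w∈gv with deg g i ≤? deg g j
  ... | yes _ = play-keeps l (beat g i j) (beat-keeps g i j w∈gv)
  ... | no  _ = play-keeps r (beat g j i) (beat-keeps g j i w∈gv)

  Consistent : (Fin n → ℚ) → Wins n → Set
  Consistent val g = ∀ v w → w ∈ g v → val w ℚ.≤ val v ℚ.+ 1ℚ

  play-run : ∀ val A g → Consistent val (graph (play A g)) →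
             Run val A (winner (play A g)) (comparisons (play A g))
  play-run val (output x)      g _ = stop
  play-run val (query i j l r) g consistent with deg g i ≤? deg g j
  ... | yes _ = left  (consistent i j (play-keeps l (beat g i j) (beat-new g i j)))
                      (play-run val l (beat g i j) consistent)
  ... | no  _ = right (consistent j i (play-keeps r (beat g j i) (beat-new g j i)))
                      (play-run val r (beat g j i) consistent)

-- The embedding ℕ→ℚ: a is the fraction a/1 in lowest terms, so it preserves
-- addition and reflects and preserves order.
ℕ→ℚ-canonical : ∀ a → ℕ→ℚ a ≡ mkℚ (ℤ.+ a) 0 (Coprime.sym (Coprime.1-coprimeTo a))
ℕ→ℚ-canonical a = ℚP.normalize-coprime (Coprime.sym (Coprime.1-coprimeTo a))

ℕ→ℚ-+ : ∀ a b → ℕ→ℚ (a + b) ≡ ℕ→ℚ a ℚ.+ ℕ→ℚ b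
ℕ→ℚ-+ a b rewrite ℕ→ℚ-canonical a | ℕ→ℚ-canonical b =
  cong (ℚ._/ 1) (sym (cong₂ ℤ._+_ (ℤP.*-identityʳ (ℤ.+ a)) (ℤP.*-identityʳ (ℤ.+ b))))

ℕ→ℚ-mono : ∀ {a b} → a ≤ b → ℕ→ℚ a ℚ.≤ ℕ→ℚ b
ℕ→ℚ-mono {a} {b} a≤b rewrite ℕ→ℚ-canonical a | ℕ→ℚ-canonical b =
  *≤* (subst₂ ℤ._≤_ (sym (ℤP.*-identityʳ (ℤ.+ a))) (sym (ℤP.*-identityʳ (ℤ.+ b))) (ℤ.+≤+ a≤b))

ℕ→ℚ-cancel : ∀ {a b} → ℕ→ℚ a ℚ.≤ ℕ→ℚ b → a ≤ b
ℕ→ℚ-cancel {a} {b} le rewrite ℕ→ℚ-canonical a | ℕ→ℚ-canonical b =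
  ℤP.drop‿+≤+ (subst₂ ℤ._≤_ (ℤP.*-identityʳ (ℤ.+ a)) (ℤP.*-identityʳ (ℤ.+ b)) (ℚP.drop-*≤* le))

-≤⇒≤+ : ∀ {p q r} → p ℚ.- q ℚ.≤ r → p ℚ.≤ r ℚ.+ q
-≤⇒≤+ {p} {q} {r} le = subst (ℚ._≤ r ℚ.+ q) cancel (ℚP.+-monoˡ-≤ q le)
  where
  cancel : p ℚ.- q ℚ.+ q ≡ p
  cancel = trans (ℚP.+-assoc p (ℚ.- q) q) (trans (cong (p ℚ.+_) (ℚP.+-inverseˡ q)) (ℚP.+-identityʳ p))

module _ {n : ℕ} (g : Wins n) (root : Fin n) where

  open Balls g root

  levelValue : ℕ → Fin n → ℚ
  levelValue r z = ℕ→ℚ (level (suc r) z)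

  levelValue-consistent : ∀ r → Consistent (levelValue r) g
  levelValue-consistent r v w w∈gv =
    subst (levelValue r w ℚ.≤_) (ℕ→ℚ-+ (level (suc r) v) 1)
      (ℕ→ℚ-mono (≤-trans (level-mono (suc r) w)
                 (≤-trans (level-edge w∈gv (suc r)) (≤-reflexive (+-comm 1 (level (suc r) v))))))

  error-covers : ∀ {A : Alg n} {r c} → HasError r A → Run (levelValue r) A root c → ∀ z → B r z
  error-covers {r = r} {c} hasError run z =
    level-≤⇒B r z (ℕ→ℚ-cancel (subst (levelValue r z ℚ.≤_) value-root
      (-≤⇒≤+ (hasError (levelValue r) root c run z))))
    where
    value-root : levelValue r root ℚ.+ ℕ→ℚ r ≡ ℕ→ℚ r
    value-root = trans (cong (λ m → ℕ→ℚ m ℚ.+ ℕ→ℚ r) (level-root (suc r))) (sym (ℕ→ℚ-+ 0 r))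

module Game {n : ℕ} (A : Alg n) where

  x : Fin n
  x = winner (play A (λ _ → []))

  c : ℕ
  c = comparisons (play A (λ _ → []))

  g : Wins n
  g = graph (play A (λ _ → []))

  open Balls g x public

  run : ∀ r → Run (levelValue g x r) A x c
  run r = play-run (levelValue g x r) A (λ _ → []) (levelValue-consistent g x r)

  ranked : AllRanked g
  ranked = play-ranked A (λ _ → []) (λ _ → _)

  edges≡c : edges g ≡ c
  edges≡c = trans (play-edges A (λ _ → [])) (trans (cong (c +_) (sum-replicate-zero n)) (+-identityʳ c))

  ball-linear : ∀ m → size (suc m) ≤ size m + c
  ball-linear m = subst (λ e → size (suc m) ≤ size m + e) edges≡c (size-linear ranked m)

  ball-square : ∀ m → size (suc m) * size (suc m) ≤ 18 * (size m * (c + size m))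
  ball-square m = square-bound (size (suc m)) (size m) c (size≥1 m) λ t →
    subst (λ e → t * size (suc m) ≤ t * size m + e + t * (t * size m)) edges≡c (size-quadratic ranked m t)

  open Recurrence size c size-0 ball-linear ball-square public

theorem15 : (k : ℕ) → k ≥ 1 →
    Σ ℕ λ a → Σ ℕ λ N → (n : ℕ) → n ≥ N → (A : Alg n) → HasError k A →
      Σ ℕ λ c → Requires A c × (n ^ (2 ^ k) ≤ suc a * c ^ (2 ^ k ∸ 1))
theorem15 k _ = a , 2 , bound
  where
  q : ℕ
  q = 2 ^ k ∸ 1
  a : ℕ
  a = K k * 2 ^ q
  bound : (n : ℕ) → n ≥ 2 → (A : Alg n) → HasError k A →
    Σ ℕ λ c → Requires A c × (n ^ (2 ^ k) ≤ suc a * c ^ q)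
  bound n n≥2 A hasError =
    c , (levelValue g x k , x , c , run k , ≤-refl) ,
    subst (λ m → m ^ (2 ^ k) ≤ suc a * c ^ q) size≡n (final k (subst (2 ≤_) (sym size≡n) n≥2))
    where
    open Game A
    size≡n : size k ≡ n
    size≡n = size-all k (error-covers g x hasError (run k))
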